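{- Let $n\in\mathbb{Z}^+$, let $\phi':\mathbb{B}^n\to\mathbb{B}$ be a Boolean function, and let $f:\mathbb{B}^{n+2}\to\mathbb{B}^{n+2}$ be a Boolean network with $f_i(\mathbf{x})=(\phi'(\mathbf{x}_{[1,n]})\wedge\neg\mathbf{x}_{n+1})\vee\mathbf{x}_{n+2}$ for all $i\in[1,n]$ (the other local functions being arbitrary). If a sub-hypercube $\mathbf{h}\in\{0,1,*\}^{n+2}$ satisfies $\mathbf{T}(\mathbf{h})_{n+1}=\mathbf{T}(\mathbf{h})_{n+2}=*$, then $\mathbf{T}(\mathbf{h})_i=*$ for all $i\in[1,n]$.
   Context: $\mathbb{B}=\{0,1\}$, $[a,b]=\{a,\dots,b\}$, and $\mathbf{x}_{[a,b]}$ denotes the subvector $(\mathbf{x}_a,\dots,\mathbf{x}_b)$. A Boolean network (BN) of dimension $m$ is a map $f:\mathbb{B}^m\to\mathbb{B}^m$ with local functions $f_i$. A sub-hypercube is a vector $\mathbf{h}\in\{0,1,*\}^m$ with vertex set $v(\mathbf{h})=\{\mathbf{x}\in\mathbb{B}^m:\forall i,\ \mathbf{h}_i\neq *\Rightarrow \mathbf{x}_i=\mathbf{h}_i\}$; $\mathbf{h}\subseteq\mathbf{h}'$ means $v(\mathbf{h})\subseteq v(\mathbf{h}')$. A trap space of $f$ is a sub-hypercube $\mathbf{h}$ with $f(\mathbf{x})\in v(\mathbf{h})$ for all $\mathbf{x}\in v(\mathbf{h})$. $\mathbf{T}(\mathbf{h})$ denotes the smallest (inclusion-wise) trap space of $f$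 containing $\mathbf{h}$. -}

module Defs where

open import Data.Nat using (ℕ; suc; _+_)
open import Data.Fin using (Fin; zero; suc; _↑ˡ_; _↑ʳ_)
open import Data.Bool using (Bool; true; false; _∧_; _∨_; not)
open import Relation.Binary.PropositionalEquality using (_≡_)

-- 𝔹 = Bool; states of a BN of dimension m are vectors Fin m → Bool
-- (index i : Fin m corresponds to coordinate i+1 of the paper).
State : ℕ → Set
State m = Fin m → Bool

BN : ℕ → Set
BN m = State m → State m

data Tri : Set where
  fix  : Bool → Tri
  star : Tri

SubHC : ℕ → Set
SubHC m = Fin m → Tri

_∈v_ : {m : ℕ} → State m → SubHC m → Set
_∈v_ {m} x h = (i : Fin m) (b : Bool) → h i ≡ fix b → x i ≡ b

_⊆h_ : {m : ℕ} → SubHC m → SubHC m → Set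
_⊆h_ {m} h h' = (x : State m) → x ∈v h → x ∈v h'

IsTrap : {m : ℕ} → BN m → SubHC m → Set
IsTrap {m} f h = (x : State m) → x ∈v h → f x ∈v h

-- t is the smallest (inclusion-wise) trap space of f containing h, i.e. t = T(h)
IsSmallestTrap : {m : ℕ} → BN m → SubHC m → SubHC m → Set
IsSmallestTrap {m} f h t =
  IsTrap f t × (h ⊆h t) × ((t' : SubHC m) → IsTrap f t' → h ⊆h t' → t ⊆h t')
  where open import Data.Product using (_×_)

-- coordinates (0-based Fin): i ∈ [1,n] ↦ i ↑ˡ 2, n+1 ↦ idxA, n+2 ↦ idxB
idxA : (n : ℕ) → Fin (n + 2)
idxA n = n ↑ʳ zero

idxB : (n : ℕ) → Fin (n + 2)
idxB n = n ↑ʳ suc zero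

prefix : (n : ℕ) → State (n + 2) → State n
prefix n x j = x (j ↑ˡ 2)

{-# OPTIONS --safe #-}
-- Only the trap property of T(h) is needed.  Since x_{n+1} and x_{n+2} are free
-- in T(h), it contains a vertex with x_{n+2} = 1, where every f_i is 1, and a
-- vertex with x_{n+1} = 1 and x_{n+2} = 0, where every f_i is 0.  A trap space
-- fixing coordinate i would force f_i to be constant on its vertices.
module Submission where

open import Defs
open import Data.Nat using (ℕ; _+_; _≤_)
open import Data.Fin using (Fin; _↑ˡ_)
open import Data.Fin.Properties using (↑ʳ-injective)
open import Data.Bool using (Bool; true; false; _∧_; _∨_; not)
open import Data.Bool.Properties using (∨-zeroʳ; ∨-identityʳ; ∧-zeroʳ)
open import Data.Product using (proj₁)
open import Data.Vec.Functional using (updateAt)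
open import Data.Vec.Functional.Properties using (updateAt-updates; updateAt-minimal)
open import Function using (const)
open import Relation.Nullary using (¬_)
open import Relation.Binary.PropositionalEquality
  using (_≡_; refl; sym; trans; cong; cong₂; module ≡-Reasoning)

module _ {m : ℕ} where

  fill : SubHC m → State m → State m
  fill t g j with t j
  ... | fix b = b
  ... | star  = g j

  fill-∈v : (t : SubHC m) (g : State m) → fill t g ∈v t
  fill-∈v t g j b eq with t j
  fill-∈v t g j b refl | fix .b = refl

  fill-star : (t : SubHC m) (g : State m) {j : Fin m} → t j ≡ star → fill t g j ≡ g j
  fill-star t g {j} eq with t j
  fill-star t g {j} refl | star = refl

  trap-fix⇒image-const : {f : BN m} {t : SubHC m} → IsTrap f t →
    {j : Fin m} {b : Bool} → t j ≡ fix b → {x : State m} → x ∈v t → f x j ≡ b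
  trap-fix⇒image-const trap tj≡b {x} x∈t = trap x x∈t _ _ tj≡b

  trap-image-both⇒star : {f : BN m} {t : SubHC m} → IsTrap f t →
    {j : Fin m} {x y : State m} → x ∈v t → y ∈v t →
    f x j ≡ true → f y j ≡ false → t j ≡ star
  trap-image-both⇒star {t = t} trap {j} x∈t y∈t fx≡1 fy≡0 with t j in tj
  ... | star       = refl
  ... | fix true   with () ← trans (sym fy≡0) (trap-fix⇒image-const trap tj y∈t)
  ... | fix false  with () ← trans (sym fx≡1) (trap-fix⇒image-const trap tj x∈t)

idxA≢idxB : (n : ℕ) → ¬ idxA n ≡ idxB n
idxA≢idxB n eq with () ← ↑ʳ-injective n _ _ eq

onesExceptB : (n : ℕ) → State (n + 2)
onesExceptB n = updateAt (const true) (idxB n) (const false)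

mainTheorem3 : (n : ℕ) → 1 ≤ n → (φ' : State n → Bool) → (f : BN (n + 2))
    → ((x : State (n + 2)) (i : Fin n) → f x (i ↑ˡ 2) ≡ ((φ' (prefix n x) ∧ not (x (idxA n))) ∨ x (idxB n)))
    → (h t : SubHC (n + 2)) → IsSmallestTrap f h t
    → t (idxA n) ≡ star → t (idxB n) ≡ star
    → (i : Fin n) → t (i ↑ˡ 2) ≡ star
mainTheorem3 n _ φ' f fᵢ h t smallest tA tB i =
  trap-image-both⇒star (proj₁ smallest) (fill-∈v t x₁) (fill-∈v t x₀) fx₁≡1 fx₀≡0
  where
  open ≡-Reasoning
  x₁ x₀ : State (n + 2)
  x₁ = const true
  x₀ = onesExceptB n

  fx₁≡1 : f (fill t x₁) (i ↑ˡ 2) ≡ true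
  fx₁≡1 = let φx = φ' (prefix n (fill t x₁)) in begin
    f (fill t x₁) (i ↑ˡ 2)                                     ≡⟨ fᵢ _ i ⟩
    (φx ∧ not (fill t x₁ (idxA n))) ∨ fill t x₁ (idxB n)       ≡⟨ cong (φx ∧ not (fill t x₁ (idxA n)) ∨_) (fill-star t x₁ tB) ⟩
    (φx ∧ not (fill t x₁ (idxA n))) ∨ true                     ≡⟨ ∨-zeroʳ _ ⟩
    true                                                       ∎

  fx₀≡0 : f (fill t x₀) (i ↑ˡ 2) ≡ false
  fx₀≡0 = let φx = φ' (prefix n (fill t x₀)) in begin
    f (fill t x₀) (i ↑ˡ 2)                                     ≡⟨ fᵢ _ i ⟩
    (φx ∧ not (fill t x₀ (idxA n))) ∨ fill t x₀ (idxB n)       ≡⟨ cong₂ (λ a b → (φx ∧ not a) ∨ b) x₀A≡1 x₀B≡0 ⟩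
    (φx ∧ false) ∨ false                                       ≡⟨ ∨-identityʳ _ ⟩
    φx ∧ false                                                 ≡⟨ ∧-zeroʳ _ ⟩
    false                                                      ∎
    where
    x₀A≡1 : fill t x₀ (idxA n) ≡ true
    x₀A≡1 = trans (fill-star t x₀ tA) (updateAt-minimal _ _ (const true) (idxA≢idxB n))
    x₀B≡0 : fill t x₀ (idxB n) ≡ false
    x₀B≡0 = trans (fill-star t x₀ tB) (updateAt-updates (idxB n) (const true))
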